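{- Let $K$ be a field with algebraic closure $\overline K$, $n\ge2$, $1\le s<n$ and $b>0$ integers. For every degree pattern $\mathbf d=(d_1,\dots,d_s)$ with $d_1\ge\cdots\ge d_s\ge1$, $d_1\cdots d_s=b$ and $\mathbf d\ne\mathbf d^{(b)}:=(b,1,\dots,1)$, $$\dim\mathbb P^{\mathbf D(\mathbf d^{(b)})}_{\overline K}\ge\dim\mathbb P^{\mathbf D(\mathbf d)}_{\overline K}+g(b).$$
   Context: $D_i(\mathbf d)=\binom{d_i+n}{n}-1$, $\mathbb P^{\mathbf D(\mathbf d)}_{\overline K}=\prod_{i=1}^s\mathbb P^{D_i(\mathbf d)}_{\overline K}$ (the space of $s$-tuples of homogeneous polynomials in $X_0,\dots,X_n$ of degrees $d_1,\dots,d_s$, each up to scalars), of dimension $\sum_iD_i(\mathbf d)$. $g(b)=0$ if $b$ is prime, and otherwise $g(b)=\binom{b+n}{n}-\binom{b/\rho+n}{n}-\binom{\rho+n}{n}$, where $\rho$ is the smallest prime dividing $b$. -}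

module Defs where

open import Data.Nat using (ℕ; zero; suc; _+_; _*_; _∸_)
open import Data.Nat.Combinatorics using (_C_)
open import Data.Nat.Primality using (Prime; prime?)
open import Data.Integer as ℤ using (ℤ; +_)
open import Data.Vec using (Vec; []; _∷_; replicate; map; sum; foldr)
open import Relation.Nullary using (yes; no)

-- D_i(d) = binom(d + n, n) - 1  (always ≥ 0, so ∸ is exact)
Dim : (n d : ℕ) → ℕ
Dim n d = ((d + n) C n) ∸ 1

dimP : (n : ℕ) {s : ℕ} → Vec ℕ s → ℕ
dimP n ds = sum (map (Dim n) ds)

prodV : {s : ℕ} → Vec ℕ s → ℕ
prodV = foldr _ _*_ 1

dB : (s b : ℕ) → Vec ℕ s
dB zero    b = []
dB (suc t) b = b ∷ replicate t 1

-- g(b), given ρ (intended: smallest prime dividing b) and q = b/ρ: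
-- 0 if b is prime, else binom(b+n,n) - binom(b/ρ+n,n) - binom(ρ+n,n)  (in ℤ)
g : (n b q ρ : ℕ) → ℤ
g n b q ρ with prime? b
... | yes _ = + 0
... | no  _ = ((+ ((b + n) C n)) ℤ.- (+ ((q + n) C n))) ℤ.- (+ ((ρ + n) C n))

module Submission where

-- Write f(m) = C(m + n, n).  Since dim P^{D(d)} = Σᵢ (f(dᵢ) − 1), the
-- corollary is an inequality between sums of values of f.  The only
-- property of f that matters is discrete convexity: its increments
-- Δ(m) = f(m+1) − f(m) = C(m + n, n − 1) are nondecreasing.
--
-- Convexity gives the
-- exchange inequality f(j + a) + f(c) ≤ f(l + c) + f(a) for a ≤ c, j ≤ l
-- ("pushing mass outwards increases the sum"), and from it
--   * f(a) + f(b) ≤ f(ab) + f(1)             (merge two factors), and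
--   * f(x) + f(y) ≤ f(q) + f(ρ)  if ρ ≤ x ≤ y and xy = qρ.
-- Merging all factors shows Σ f(dᵢ) ≤ Σ f(d⁽ᵇ⁾ᵢ) for every pattern d
-- (the case b prime, where g(b) = 0).  If d ≠ d⁽ᵇ⁾ then d₂ ≥ 2, so the
-- smallest prime ρ of b is ≤ d₂, and splitting b = d₂ · (d₁ d₃ ⋯ dₛ)
-- gains the extra f(b) − f(q) − f(ρ) = g(b).

open import Defs
open import Data.Nat using (ℕ; _≤_; _<_; _*_)
open import Data.Nat.Divisibility using (_∣_)
open import Data.Nat.Primality using (Prime)
open import Data.Fin using (Fin) renaming (_≤_ to _≤ᶠ_)
open import Data.Vec using (Vec; lookup)
open import Data.Integer as ℤ using (+_)
open import Relation.Binary.PropositionalEquality using (_≡_; _≢_)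

open import Data.Nat using (zero; suc; _+_; _∸_; z≤n; s≤s; NonZero; _≤′_; ≤′-refl; ≤′-step)
open import Data.Nat.Properties
open import Data.Nat.Divisibility using (∣-trans; ∣⇒≤; m∣m*n)
open import Data.Nat.Primality using (prime?; prime⇒nonZero)
open import Data.Nat.Primality.Factorisation using (factorise)
open import Data.Nat.Combinatorics using (_C_; nCk+nC[k+1]≡[n+1]C[k+1]; nCn≡1)
open import Data.Nat.ListAction using (product)
open import Data.Nat.Tactic.RingSolver using (solve-∀)
open import Data.Fin using (zero; suc)
open import Data.Vec using ([]; _∷_; replicate; map; sum)
open import Data.List using ([]; _∷_)
open import Data.List.Relation.Unary.All using (_∷_)
open import Data.Integer.Properties as ℤₚ using ()
import Data.Integer.Tactic.RingSolver as ℤ-Solver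
open import Data.Empty using (⊥-elim)
open import Data.Product using (∃; _×_; _,_)
open import Relation.Nullary using (yes; no)
open import Relation.Binary.PropositionalEquality
  using (refl; sym; trans; cong; cong₂; subst; subst₂; module ≡-Reasoning)

mono-from-steps : (h : ℕ → ℕ) → (∀ m → h m ≤ h (suc m)) → ∀ {a c} → a ≤ c → h a ≤ h c
mono-from-steps h step a≤c = go (≤⇒≤′ a≤c)
  where
  go : ∀ {a c} → a ≤′ c → h a ≤ h c
  go ≤′-refl      = ≤-refl
  go (≤′-step a≤c) = ≤-trans (go a≤c) (step _)

Positive : ∀ {s} → Vec ℕ s → Set
Positive d = ∀ i → 1 ≤ lookup d i

Sorted : ∀ {s} → Vec ℕ s → Set
Sorted {s} d = ∀ (i j : Fin s) → i ≤ᶠ j → lookup d j ≤ lookup d i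

prodV-positive : ∀ {s} (d : Vec ℕ s) → Positive d → 1 ≤ prodV d
prodV-positive []       _   = s≤s z≤n
prodV-positive (x ∷ xs) pos = *-mono-≤ (pos zero) (prodV-positive xs (λ i → pos (suc i)))

ones-tail⇒dB : ∀ {t b} x (xs : Vec ℕ t) → (∀ i → lookup xs i ≡ 1) →
               prodV (x ∷ xs) ≡ b → x ∷ xs ≡ dB (suc t) b
ones-tail⇒dB {t} {b} x xs ones prod = cong₂ _∷_ x≡b (xs≡1s ones)
  where
  xs≡1s : ∀ {t} {xs : Vec ℕ t} → (∀ i → lookup xs i ≡ 1) → xs ≡ replicate t 1
  xs≡1s {xs = []}     _    = refl
  xs≡1s {xs = _ ∷ _} ones = cong₂ _∷_ (ones zero) (xs≡1s (λ i → ones (suc i)))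
  prod-ones : ∀ t → prodV (replicate t 1) ≡ 1
  prod-ones zero    = refl
  prod-ones (suc t) = trans (+-identityʳ _) (prod-ones t)
  x≡b : x ≡ b
  x≡b = begin
    x                         ≡⟨ sym (*-identityʳ x) ⟩
    x * 1                     ≡⟨ cong (x *_) (sym (prod-ones t)) ⟩
    x * prodV (replicate t 1) ≡⟨ cong (λ r → x * prodV r) (sym (xs≡1s {xs = xs} ones)) ⟩
    x * prodV xs              ≡⟨ prod ⟩
    b                         ∎
    where open ≡-Reasoning

prime-divisor : ∀ x → 2 ≤ x → ∃ λ p → Prime p × p ∣ x
prime-divisor (suc zero) (s≤s ())
prime-divisor x@(suc (suc _)) _ with factorise x
... | record { factors = [] ; isFactorisation = () }
... | record { factors = p ∷ ps ; isFactorisation = e ; factorsPrime = p-prime ∷ _ } =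
      p , p-prime , subst (p ∣_) (sym e) (m∣m*n (product ps))

smallest-prime-≤ : ∀ {ρ b x} → (∀ p → Prime p → p ∣ b → ρ ≤ p) → 2 ≤ x → x ∣ b → ρ ≤ x
smallest-prime-≤ {x = x@(suc _)} ρ-min x≥2 x∣b with prime-divisor x x≥2
... | p , p-prime , p∣x = ≤-trans (ρ-min p p-prime (∣-trans p∣x x∣b)) (∣⇒≤ p∣x)

module Convex (f Δ : ℕ → ℕ)
              (f-step : ∀ m → f (suc m) ≡ Δ m + f m)
              (Δ-mono : ∀ {a c} → a ≤ c → Δ a ≤ Δ c) where

  f-mono : ∀ {a c} → a ≤ c → f a ≤ f c
  f-mono = mono-from-steps f (λ m → subst (f m ≤_) (sym (f-step m)) (m≤n+m (f m) (Δ m)))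

  exchange : ∀ j {a c} → a ≤ c → f (j + a) + f c ≤ f (j + c) + f a
  exchange zero    {a} {c} _   = ≤-reflexive (+-comm (f a) (f c))
  exchange (suc j) {a} {c} a≤c = begin
    f (suc (j + a)) + f c         ≡⟨ cong (_+ f c) (f-step (j + a)) ⟩
    Δ (j + a) + f (j + a) + f c   ≡⟨ +-assoc (Δ (j + a)) _ _ ⟩
    Δ (j + a) + (f (j + a) + f c) ≤⟨ +-mono-≤ (Δ-mono (+-monoʳ-≤ j a≤c)) (exchange j a≤c) ⟩
    Δ (j + c) + (f (j + c) + f a) ≡⟨ +-assoc (Δ (j + c)) _ _ ⟨
    Δ (j + c) + f (j + c) + f a   ≡⟨ cong (_+ f a) (f-step (j + c)) ⟨
    f (suc (j + c)) + f a         ∎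
    where open ≤-Reasoning

  spread : ∀ {a c j l} → a ≤ c → j ≤ l → f (j + a) + f c ≤ f (l + c) + f a
  spread {a} a≤c j≤l = ≤-trans (exchange _ a≤c) (+-monoˡ-≤ (f a) (f-mono (+-monoˡ-≤ _ j≤l)))

  merge-two : ∀ {a b} → 1 ≤ a → 1 ≤ b → f a + f b ≤ f (a * b) + f 1
  merge-two {suc a} {suc b} _ _ = begin
    f (suc a) + f (suc b)         ≡⟨ cong (λ z → f z + f (suc b)) (+-comm 1 a) ⟩
    f (a + 1) + f (suc b)         ≤⟨ spread (s≤s z≤n) (m≤m*n a (suc b)) ⟩
    f (a * suc b + suc b) + f 1   ≡⟨ cong (λ z → f z + f 1) (+-comm (a * suc b) (suc b)) ⟩
    f (suc a * suc b) + f 1       ∎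
    where open ≤-Reasoning

  refactor : ∀ {ρ x y q} .{{_ : NonZero ρ}} → ρ ≤ x → x ≤ y → x * y ≡ q * ρ →
             f x + f y ≤ f q + f ρ
  refactor {ρ} {x} {y} {q} ρ≤x x≤y xy≡qρ =
    subst₂ (λ a b → f a + f y ≤ f b + f ρ) u+ρ≡x (m∸n+n≡m y≤q)
      (spread (≤-trans ρ≤x x≤y) (m+n≤o⇒m≤o∸n u u+y≤q))
    where
    u = x ∸ ρ
    u+ρ≡x : u + ρ ≡ x
    u+ρ≡x = m∸n+n≡m ρ≤x
    ρ[u+y]≤ρq : ρ * (u + y) ≤ ρ * q
    ρ[u+y]≤ρq = begin
      ρ * (u + y)    ≡⟨ *-distribˡ-+ ρ u y ⟩
      ρ * u + ρ * y  ≡⟨ cong (_+ ρ * y) (*-comm ρ u) ⟩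
      u * ρ + ρ * y  ≤⟨ +-monoˡ-≤ (ρ * y) (*-monoʳ-≤ u (≤-trans ρ≤x x≤y)) ⟩
      u * y + ρ * y  ≡⟨ *-distribʳ-+ y u ρ ⟨
      (u + ρ) * y    ≡⟨ cong (_* y) u+ρ≡x ⟩
      x * y          ≡⟨ xy≡qρ ⟩
      q * ρ          ≡⟨ *-comm q ρ ⟩
      ρ * q          ∎
      where open ≤-Reasoning
    u+y≤q : u + y ≤ q
    u+y≤q = *-cancelˡ-≤ ρ ρ[u+y]≤ρq
    y≤q : y ≤ q
    y≤q = m+n≤o⇒n≤o u u+y≤q

  sumf : ∀ {s} → Vec ℕ s → ℕ
  sumf d = sum (map f d)

  sumf-dB : ∀ t b → sumf (dB (suc t) b) ≡ f b + t * f 1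
  sumf-dB t b = cong (λ z → f b + z) (ones t)
    where
    ones : ∀ t → sumf (replicate t 1) ≡ t * f 1
    ones zero    = refl
    ones (suc t) = cong (λ z → f 1 + z) (ones t)

  merge-all : ∀ {t} x (xs : Vec ℕ t) → 1 ≤ x → Positive xs →
              f x + sumf xs ≤ f (x * prodV xs) + t * f 1
  merge-all x []       _   _   = ≤-reflexive (cong (λ z → f z + 0) (sym (*-identityʳ x)))
  merge-all {suc t} x (y ∷ ys) x≥1 pos = begin
    f x + (f y + sumf ys)           ≤⟨ +-monoʳ-≤ (f x) (merge-all y ys (pos zero) (λ i → pos (suc i))) ⟩
    f x + (f (y * P) + t * f 1)     ≡⟨ +-assoc (f x) _ _ ⟨
    f x + f (y * P) + t * f 1       ≤⟨ +-monoˡ-≤ (t * f 1) (merge-two x≥1 (prodV-positive (y ∷ ys) pos)) ⟩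
    f (x * (y * P)) + f 1 + t * f 1 ≡⟨ +-assoc (f (x * (y * P))) _ _ ⟩
    f (x * (y * P)) + (f 1 + t * f 1) ∎
    where
    open ≤-Reasoning
    P = prodV ys

  dB-maximal : ∀ {t b} (d : Vec ℕ (suc t)) → Positive d → prodV d ≡ b →
               sumf d ≤ sumf (dB (suc t) b)
  dB-maximal {t} {b} (x ∷ xs) pos prod = begin
    f x + sumf xs               ≤⟨ merge-all x xs (pos zero) (λ i → pos (suc i)) ⟩
    f (x * prodV xs) + t * f 1  ≡⟨ cong (λ z → f z + t * f 1) prod ⟩
    f b + t * f 1               ≡⟨ sumf-dB t b ⟨
    sumf (dB (suc t) b)         ∎
    where open ≤-Reasoning

  -- Since d ≠ d⁽ᵇ⁾, its second entry x is ≥ 2, hence ρ ≤ x; merging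
  -- the other entries into y = b / x and refactoring (x, y) into (q, ρ) gives the gain.
  dB-gap : ∀ {t b q ρ} .{{_ : NonZero ρ}} → (∀ p → Prime p → p ∣ b → ρ ≤ p) → b ≡ q * ρ →
           (d : Vec ℕ (suc t)) → Sorted d → Positive d → prodV d ≡ b → d ≢ dB (suc t) b →
           sumf d + f b ≤ sumf (dB (suc t) b) + (f q + f ρ)
  dB-gap _ _ (x ∷ []) _ _ prod d≢dB = ⊥-elim (d≢dB (ones-tail⇒dB x [] (λ ()) prod))
  dB-gap {suc u} {b} {q} {ρ} ρ-min b≡qρ (d₁ ∷ x ∷ rest) sorted pos prod d≢dB with x ≤? 1
  ... | yes x≤1 = ⊥-elim (d≢dB (ones-tail⇒dB d₁ (x ∷ rest) ones prod))
    where
    ones : ∀ i → lookup (x ∷ rest) i ≡ 1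
    ones i = ≤-antisym (≤-trans (sorted (suc zero) (suc i) (s≤s z≤n)) x≤1) (pos (suc i))
  ... | no x≰1 = begin
    f d₁ + (f x + sumf rest) + f b   ≡⟨ cong (_+ f b) (swap (f d₁) (f x) (sumf rest)) ⟩
    f x + (f d₁ + sumf rest) + f b   ≤⟨ +-monoˡ-≤ (f b) (+-monoʳ-≤ (f x) (merge-all d₁ rest d₁≥1 (λ i → pos (suc (suc i))))) ⟩
    f x + (f y + u * f 1) + f b      ≡⟨ regroup (f x) (f y) (u * f 1) (f b) ⟩
    f b + u * f 1 + (f x + f y)      ≤⟨ +-mono-≤ (+-monoʳ-≤ (f b) (m≤n+m (u * f 1) (f 1))) (refactor ρ≤x x≤y (trans xy≡b b≡qρ)) ⟩
    f b + (f 1 + u * f 1) + (f q + f ρ) ≡⟨ cong (_+ (f q + f ρ)) (sumf-dB (suc u) b) ⟨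
    sumf (dB (suc (suc u)) b) + (f q + f ρ) ∎
    where
    open ≤-Reasoning
    swap : ∀ a b c → a + (b + c) ≡ b + (a + c)
    swap = solve-∀
    regroup : ∀ a b c e → a + (b + c) + e ≡ e + c + (a + b)
    regroup = solve-∀
    y = d₁ * prodV rest
    x≤d₁ : x ≤ d₁
    x≤d₁ = sorted zero (suc zero) z≤n
    d₁≥1 : 1 ≤ d₁
    d₁≥1 = pos zero
    x≤y : x ≤ y
    x≤y = ≤-trans x≤d₁ (subst (_≤ y) (*-identityʳ d₁)
            (*-monoʳ-≤ d₁ (prodV-positive rest (λ i → pos (suc (suc i))))))
    xy≡b : x * y ≡ b
    xy≡b = trans (commute x d₁ (prodV rest)) prod
      where
      commute : ∀ a b c → a * (b * c) ≡ b * (a * c)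
      commute = solve-∀
    ρ≤x : ρ ≤ x
    ρ≤x = smallest-prime-≤ ρ-min (≰⇒> x≰1) (subst (x ∣_) xy≡b (m∣m*n y))

C-mono : ∀ r {N M} → N ≤ M → N C r ≤ M C r
C-mono r = mono-from-steps (_C r) (step r)
  where
  step : ∀ r N → N C r ≤ suc N C r
  step zero    N = ≤-refl
  step (suc j) N = subst (N C suc j ≤_) (nCk+nC[k+1]≡[n+1]C[k+1] N j) (m≤n+m _ _)

module Binomial (k : ℕ) where

  binom : ℕ → ℕ
  binom m = (m + suc k) C suc k

  increment : ℕ → ℕ
  increment m = (m + suc k) C k

  pascal : ∀ m → binom (suc m) ≡ increment m + binom m
  pascal m = sym (nCk+nC[k+1]≡[n+1]C[k+1] (m + suc k) k)

  increment-mono : ∀ {a c} → a ≤ c → increment a ≤ increment c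
  increment-mono a≤c = C-mono k (+-monoˡ-≤ (suc k) a≤c)

  open Convex binom increment pascal increment-mono public

  binom-positive : ∀ m → 1 ≤ binom m
  binom-positive m = ≤-trans (≤-reflexive (sym (nCn≡1 (suc k)))) (f-mono {c = m} z≤n)

  -- dim P^{D(d)} + s = Σᵢ C(dᵢ + n, n), as each D_i(d) = C(dᵢ + n, n) − 1 is exact.
  dimP+s≡sumf : ∀ {s} (d : Vec ℕ s) → dimP (suc k) d + s ≡ sumf d
  dimP+s≡sumf []       = refl
  dimP+s≡sumf {suc s} (x ∷ xs) = begin
    binom x ∸ 1 + dimP (suc k) xs + suc s     ≡⟨ shift (binom x ∸ 1) (dimP (suc k) xs) s ⟩
    (binom x ∸ 1 + 1) + (dimP (suc k) xs + s) ≡⟨ cong₂ _+_ (m∸n+n≡m (binom-positive x)) (dimP+s≡sumf xs) ⟩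
    binom x + sumf xs                         ∎
    where
    open ≡-Reasoning
    shift : ∀ a b c → a + b + suc c ≡ (a + 1) + (b + c)
    shift = solve-∀

  dimP-≤ : ∀ {s} (d e : Vec ℕ s) {a c} → sumf d + a ≤ sumf e + c → dimP (suc k) d + a ≤ dimP (suc k) e + c
  dimP-≤ {s} d e {a} {c} le = +-cancelʳ-≤ s _ _ (begin
    dimP (suc k) d + a + s ≡⟨ move (dimP (suc k) d) a s ⟩
    dimP (suc k) d + s + a ≡⟨ cong (_+ a) (dimP+s≡sumf d) ⟩
    sumf d + a             ≤⟨ le ⟩
    sumf e + c             ≡⟨ cong (_+ c) (dimP+s≡sumf e) ⟨
    dimP (suc k) e + s + c ≡⟨ move (dimP (suc k) e) c s ⟨
    dimP (suc k) e + c + s ∎)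
    where
    open ≤-Reasoning
    move : ∀ x y z → x + y + z ≡ x + z + y
    move = solve-∀

ℤ-rearrange : ∀ P Q B C D → P + B ≤ Q + (C + D) →
              + P ℤ.+ ((+ B ℤ.- + C) ℤ.- + D) ℤ.≤ + Q
ℤ-rearrange P Q B C D le = begin
  + P ℤ.+ ((+ B ℤ.- + C) ℤ.- + D) ≡⟨ collect (+ P) (+ B) (+ C) (+ D) ⟩
  + (P + B) ℤ.- + (C + D)         ≤⟨ ℤₚ.+-monoˡ-≤ (ℤ.- + (C + D)) (ℤ.+≤+ le) ⟩
  + (Q + (C + D)) ℤ.- + (C + D)   ≡⟨ cancel (+ Q) (+ (C + D)) ⟩
  + Q                             ∎
  where
  open ℤₚ.≤-Reasoning
  collect : ∀ p b c d → p ℤ.+ ((b ℤ.- c) ℤ.- d) ≡ (p ℤ.+ b) ℤ.- (c ℤ.+ d)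
  collect = ℤ-Solver.solve-∀
  cancel : ∀ q e → (q ℤ.+ e) ℤ.- e ≡ q
  cancel = ℤ-Solver.solve-∀

-- Write n = k + 1 and s = t + 1.
-- For b prime g(b) = 0 and d⁽ᵇ⁾ is maximal; otherwise the gap bound applies.
corollary5p2 : (n s b : ℕ) → 2 ≤ n → 1 ≤ s → s < n → 0 < b →
    (ρ q : ℕ) → Prime ρ → b ≡ q * ρ → (∀ p → Prime p → p ∣ b → ρ ≤ p) →
    (d : Vec ℕ s) →
    (∀ (i j : Fin s) → i ≤ᶠ j → lookup d j ≤ lookup d i) →
    (∀ (i : Fin s) → 1 ≤ lookup d i) →
    prodV d ≡ b →
    d ≢ dB s b →
    + dimP n (dB s b) ℤ.≥ (+ dimP n d) ℤ.+ g n b q ρ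
corollary5p2 (suc k) (suc t) b _ _ _ _ ρ q ρ-prime b≡qρ ρ-min d sorted pos prod d≢dB
  with prime? b
... | yes _ = ℤ.+≤+ (subst (dimP (suc k) d + 0 ≤_) (+-identityʳ _)
                (dimP-≤ d e (+-monoˡ-≤ 0 (dB-maximal d pos prod))))
  where
  open Binomial k
  e = dB (suc t) b
... | no _ = ℤ-rearrange (dimP (suc k) d) (dimP (suc k) e) (binom b) (binom q) (binom ρ)
               (dimP-≤ d e (dB-gap {q = q} ρ-min b≡qρ d sorted pos prod d≢dB))
  where
  open Binomial k
  e = dB (suc t) b
  instance _ = prime⇒nonZero ρ-prime
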